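{- Let $H$ be a hypergraph and let $M=(v_1h_1,\dots,v_kh_k)$ be a $C$-matching in $\mathrm{IG}(H)$, with $M_V=\{v_1,\dots,v_k\}$. Then $V(H)\setminus M_V$ is a lazy burning set for $H$. Moreover, $m(H)=|V(H)|-b_L(H)$.
   Context: A hypergraph $H$ consists of a finite vertex set $V(H)$ and a finite collection $E(H)$ of subsets of $V(H)$ (hyperedges). Lazy burning on $H$: a set $B\subseteq V(H)$ is burned initially; in each subsequent round, every unburned vertex $v$ for which there is a hyperedge $h\ni v$ whose other vertices $h\setminus\{v\}$ are all burned becomes burned (in particular a vertex in a singleton hyperedge burns immediately). $B$ is a lazy burning set if eventually all vertices are burned; the lazy burning number $b_L(H)$ is the minimum size of a lazy burning set. The incidence graph $\mathrm{IG}(H)$ is the bipartite graph with parts $V(H)$ and $E(H)$, where $v\in V(H)$ is adjacent to $h\in E(H)$ iff $v\in h$; its edges are written $vh$. A $C$-matching in $\mathrm{IG}(H)$ is a list $(v_1h_1,\dots,v_kh_k)$ of edges of $\mathrm{IG}(H)$ (so $v_i\in h_i$) such that $h_i\cap\{v_{i+1},\dots,v_k\}=\emptyset$ for every $1\le i\le k$. $m(H)$ denotes the maximum length $k$ of a $C$-matching in $\mathrm{IG}(H)$. -}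

module Defs where

open import Data.Nat using (ℕ; _≤_)
open import Data.Fin using (Fin)
open import Data.Fin.Subset using (Subset; _∈_; _∉_; ∁; _∪_; ⁅_⁆; ∣_∣; ⊥)
open import Data.List using (List; []; _∷_; length; lookup)
open import Data.List.Relation.Unary.All using (All)
open import Data.Product using (_×_; Σ; proj₁; _,_)
open import Relation.Binary.PropositionalEquality using (_≡_; _≢_)

-- A hypergraph on the vertex set Fin n; hyperedges are a finite list of
-- subsets of the vertex set (a list, so repeated hyperedges are allowed).
record Hypergraph : Set where
  constructor mkHypergraph
  field
    n     : ℕ
    edges : List (Subset n)
open Hypergraph public

Edge : Hypergraph → Set
Edge H = Fin (length (edges H))

edge : (H : Hypergraph) → Edge H → Subset (n H)
edge H i = lookup (edges H) i

data Burned (H : Hypergraph) (B : Subset (n H)) : Fin (n H) → Set where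
  initial : ∀ {v} → v ∈ B → Burned H B v
  spread  : ∀ {v} (h : Edge H) → v ∈ edge H h →
            (∀ u → u ∈ edge H h → u ≢ v → Burned H B u) → Burned H B v

IsLazyBurningSet : (H : Hypergraph) → Subset (n H) → Set
IsLazyBurningSet H B = ∀ v → Burned H B v

IsLazyBurningNumber : Hypergraph → ℕ → Set
IsLazyBurningNumber H b =
  Σ (Subset (n H)) (λ B → IsLazyBurningSet H B × ∣ B ∣ ≡ b)
  × (∀ B → IsLazyBurningSet H B → b ≤ ∣ B ∣)

-- C-matchings in IG(H): a list of incidence-graph edges (v , h) with v ∈ h,
-- such that h_i contains none of v_{i+1},...,v_k.
data IsCMatching (H : Hypergraph) : List (Fin (n H) × Edge H) → Set where
  []  : IsCMatching H []
  _∷_ : ∀ {v h M} →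
        (v ∈ edge H h) × All (λ p → proj₁ p ∉ edge H h) M →
        IsCMatching H M → IsCMatching H ((v , h) ∷ M)

matchedVertices : (H : Hypergraph) → List (Fin (n H) × Edge H) → Subset (n H)
matchedVertices H []            = ⊥
matchedVertices H ((v , _) ∷ M) = ⁅ v ⁆ ∪ matchedVertices H M

IsMaxCMatchingSize : Hypergraph → ℕ → Set
IsMaxCMatchingSize H k =
  Σ (List (Fin (n H) × Edge H)) (λ M → IsCMatching H M × length M ≡ k)
  × (∀ M → IsCMatching H M → length M ≤ k)

-- Burning along a C-matching: if h₁ avoids v₂,…,v_k, then once everything
-- outside {v₁,…,v_k} is burned, v₁ burns through h₁, then v₂ through h₂, and
-- so on; hence V ∖ M_V is a lazy burning set and m(H) ≤ |V| − b_L(H).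
-- Conversely, recording the burning of a lazy burning set B as the list of
-- pairs (v, h) with v burned through h, in burning order, gives a C-matching
-- of length |V| − |B|: when v burns through h, every other vertex of h is
-- already burned, so h contains no later vertex.
module Submission where

open import Defs
open import Data.Nat using (ℕ; _∸_)
open import Data.Fin.Subset using (Subset; ∁)
open import Data.Fin using (Fin)
open import Data.List using (List)
open import Data.Product using (_×_; ∃-syntax)

open import Level using (Level)
open import Data.Nat using (zero; suc; _+_; _≤_; _<_; s≤s; s≤s⁻¹; _≤?_)
open import Data.Nat.Properties
  using (≤-refl; ≤-trans; ≤-antisym; ≤-reflexive; <-≤-trans; ≮⇒≥; <⇒≱; +-suc;
         +-comm; +-identityʳ; m≤n+m; m≤n+o⇒m∸n≤o; m+n≤o⇒m≤o∸n; m≤o∸n⇒m+n≤o;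
         module ≤-Reasoning)
open import Data.Fin using (zero; suc; _≟_)
open import Data.Fin.Subset using (_∈_; _∉_; _∪_; ⁅_⁆; ∣_∣; ⊤; _⊆_; inside; outside)
open import Data.Fin.Subset.Properties
  using (_∈?_; ∉⊥; ∈⊤; x∈⁅x⁆; x∈⁅y⁆⇒x≡y; x∈p∪q⁻; x∈p∪q⁺; ∪-identityˡ; ∣⊥∣≡0;
         ∣⊤∣≡n; ∣p∣≤n; p⊆q⇒∣p∣≤∣q∣; ∣∁p∣≡n∸∣p∣; x∉p⇒x∈∁p; anySubset?)
open import Data.Fin.Properties using (any?; all?)
open import Data.List using ([]; _∷_; length; _∷ʳ_)
open import Data.List.Properties using (length-++)
open import Data.List.Relation.Unary.All using (All; []; _∷_) renaming (map to All-map)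
open import Data.List.Relation.Unary.All.Properties using (∷ʳ⁺)
open import Data.Product using (Σ; _,_; proj₁; proj₂)
open import Data.Sum using (_⊎_; inj₁; inj₂; [_,_]′)
open import Data.Vec using (_∷_; here; there)
open import Relation.Nullary using (Dec; yes; no; ¬_; contradiction)
open import Relation.Nullary.Decidable using (_×-dec_; _→-dec_; ¬?)
open import Relation.Unary using (Pred; Decidable)
open import Relation.Binary.PropositionalEquality
  using (_≡_; _≢_; refl; sym; trans; cong; subst; module ≡-Reasoning)
open import Function using (_∘_)

private
  variable
    ℓ : Level
    A : Set ℓ
    m : ℕ

length-∷ʳ : ∀ (xs : List A) {x} → length (xs ∷ʳ x) ≡ suc (length xs)
length-∷ʳ xs = trans (length-++ xs) (+-comm (length xs) 1)

x∈⁅y⁆∪p⁻ : ∀ {x} y (p : Subset m) → x ∈ ⁅ y ⁆ ∪ p → x ≡ y ⊎ x ∈ p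
x∈⁅y⁆∪p⁻ y p x∈ with x∈p∪q⁻ ⁅ y ⁆ p x∈
... | inj₁ x∈⁅y⁆ = inj₁ (x∈⁅y⁆⇒x≡y y x∈⁅y⁆)
... | inj₂ x∈p   = inj₂ x∈p

x∉p⇒∣⁅x⁆∪p∣≡1+∣p∣ : ∀ (x : Fin m) (p : Subset m) → x ∉ p → ∣ ⁅ x ⁆ ∪ p ∣ ≡ suc ∣ p ∣
x∉p⇒∣⁅x⁆∪p∣≡1+∣p∣ zero    (outside ∷ p) x∉p = cong (suc ∘ ∣_∣) (∪-identityˡ p)
x∉p⇒∣⁅x⁆∪p∣≡1+∣p∣ zero    (inside  ∷ p) x∉p = contradiction here x∉p
x∉p⇒∣⁅x⁆∪p∣≡1+∣p∣ (suc x) (outside ∷ p) x∉p = x∉p⇒∣⁅x⁆∪p∣≡1+∣p∣ x p (x∉p ∘ there)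
x∉p⇒∣⁅x⁆∪p∣≡1+∣p∣ (suc x) (inside  ∷ p) x∉p = cong suc (x∉p⇒∣⁅x⁆∪p∣≡1+∣p∣ x p (x∉p ∘ there))

x∉p⇒∣p∣<n : ∀ (x : Fin m) (p : Subset m) → x ∉ p → ∣ p ∣ < m
x∉p⇒∣p∣<n x p x∉p = subst (_≤ _) (x∉p⇒∣⁅x⁆∪p∣≡1+∣p∣ x p x∉p) (∣p∣≤n (⁅ x ⁆ ∪ p))

minimumCardinality : {P : Pred (Subset m) ℓ} → Decidable P → ∀ {p} → P p →
  ∃[ q ] (P q × ∀ r → P r → ∣ q ∣ ≤ ∣ r ∣)
minimumCardinality {P = P} P? {p} Pp = descend ∣ p ∣ p ≤-refl Pp
  where
  descend : ∀ k p → ∣ p ∣ ≤ k → P p → ∃[ q ] (P q × ∀ r → P r → ∣ q ∣ ≤ ∣ r ∣)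
  descend k p ∣p∣≤k Pp with anySubset? (λ q → P? q ×-dec suc ∣ q ∣ ≤? ∣ p ∣)
  ... | no ∄smaller = p , Pp , λ r Pr → ≮⇒≥ λ r<p → ∄smaller (r , Pr , r<p)
  descend (suc k) p ∣p∣≤k Pp | yes (q , Pq , q<p) = descend k q (s≤s⁻¹ (<-≤-trans q<p ∣p∣≤k)) Pq
  descend zero    p ∣p∣≤k Pp | yes (q , Pq , q<p) = contradiction (<-≤-trans q<p ∣p∣≤k) λ ()

module _ (H : Hypergraph) where

  private
    V = Fin (n H)
    IGEdges = List (V × Edge H)

  ∉-matchedVertices : ∀ {h u} (M : IGEdges) → All (λ p → proj₁ p ∉ edge H h) M →
    u ∈ edge H h → u ∉ matchedVertices H M
  ∉-matchedVertices []            []            u∈h = ∉⊥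
  ∉-matchedVertices ((v , _) ∷ M) (v∉h ∷ M∉h) u∈h u∈
    with x∈⁅y⁆∪p⁻ v (matchedVertices H M) u∈
  ... | inj₁ refl = v∉h u∈h
  ... | inj₂ u∈M  = ∉-matchedVertices M M∉h u∈h u∈M

  ∣matchedVertices∣≡length : ∀ {M} → IsCMatching H M → ∣ matchedVertices H M ∣ ≡ length M
  ∣matchedVertices∣≡length []                           = ∣⊥∣≡0 (n H)
  ∣matchedVertices∣≡length (_∷_ {v} {M = M} (v∈h , M∉h) cm) = begin
    ∣ ⁅ v ⁆ ∪ matchedVertices H M ∣ ≡⟨ x∉p⇒∣⁅x⁆∪p∣≡1+∣p∣ v _ (∉-matchedVertices M M∉h v∈h) ⟩
    suc ∣ matchedVertices H M ∣     ≡⟨ cong suc (∣matchedVertices∣≡length cm) ⟩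
    suc (length M)                  ∎
    where open ≡-Reasoning

  burnedOffMatching⇒isLazyBurningSet : ∀ {B M} → IsCMatching H M →
    (∀ u → u ∉ matchedVertices H M → Burned H B u) → IsLazyBurningSet H B
  burnedOffMatching⇒isLazyBurningSet []                  burned v = burned v ∉⊥
  burnedOffMatching⇒isLazyBurningSet {B} (_∷_ {v} {h} {M} (v∈h , M∉h) cm) burned =
    burnedOffMatching⇒isLazyBurningSet cm burned′
    where
    burned′ : ∀ u → u ∉ matchedVertices H M → Burned H B u
    burned′ u u∉M with u ≟ v
    ... | yes refl = spread h v∈h λ w w∈h w≢v → burned w λ w∈ →
      [ w≢v , ∉-matchedVertices M M∉h w∈h ]′ (x∈⁅y⁆∪p⁻ v _ w∈)
    ... | no u≢v = burned u λ u∈ → [ u≢v , u∉M ]′ (x∈⁅y⁆∪p⁻ v _ u∈)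

  ∁matchedVertices-isLazyBurningSet : ∀ M → IsCMatching H M →
    IsLazyBurningSet H (∁ (matchedVertices H M))
  ∁matchedVertices-isLazyBurningSet M cm =
    burnedOffMatching⇒isLazyBurningSet cm λ u u∉M → initial (x∉p⇒x∈∁p u∉M)

  cMatching-length≤n∸b : ∀ {b} → (∀ B → IsLazyBurningSet H B → b ≤ ∣ B ∣) →
    ∀ M → IsCMatching H M → length M ≤ n H ∸ b
  cMatching-length≤n∸b {b} minimal M cm =
    m+n≤o⇒m≤o∸n (length M) (subst (_≤ n H) (+-comm b (length M)) (m≤o∸n⇒m+n≤o b len≤n b≤n∸len))
    where
    ∣M∣≡len : ∣ matchedVertices H M ∣ ≡ length M
    ∣M∣≡len = ∣matchedVertices∣≡length cm
    len≤n : length M ≤ n H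
    len≤n = subst (_≤ n H) ∣M∣≡len (∣p∣≤n (matchedVertices H M))
    b≤n∸len : b ≤ n H ∸ length M
    b≤n∸len = subst (b ≤_) (trans (∣∁p∣≡n∸∣p∣ (matchedVertices H M)) (cong (n H ∸_) ∣M∣≡len))
                (minimal _ (∁matchedVertices-isLazyBurningSet M cm))

  EdgesWithin : Subset (n H) → IGEdges → Set
  EdgesWithin S = All (λ p → edge H (proj₂ p) ⊆ S)

  Burnable : Subset (n H) → V → Edge H → Set
  Burnable S v h = v ∉ S × v ∈ edge H h × (∀ u → u ∈ edge H h → u ≢ v → u ∈ S)

  burnable? : ∀ S → Dec (∃[ v ] ∃[ h ] Burnable S v h)
  burnable? S = any? λ v → any? λ h → ¬? (v ∈? S) ×-dec (v ∈? edge H h) ×-dec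
    all? (λ u → (u ∈? edge H h) →-dec (¬? (u ≟ v) →-dec (u ∈? S)))

  isCMatching-∷ʳ : ∀ {S v h M} → IsCMatching H M → EdgesWithin S M → v ∉ S →
    v ∈ edge H h → IsCMatching H (M ∷ʳ (v , h))
  isCMatching-∷ʳ []                         []            v∉S v∈h = (v∈h , []) ∷ []
  isCMatching-∷ʳ ((w∈h′ , M∉h′) ∷ cm) (h′⊆S ∷ M⊆S) v∉S v∈h =
    (w∈h′ , ∷ʳ⁺ M∉h′ (v∉S ∘ h′⊆S)) ∷ isCMatching-∷ʳ cm M⊆S v∉S v∈h

  -- A partial run of the burning process from B: `burnt` is burned so far,
  -- and `order` lists, in burning order, the vertices burned after B together
  -- with the hyperedges they burned through.
  record BurningRun (B : Subset (n H)) : Set where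
    field
      burnt        : Subset (n H)
      order        : IGEdges
      isCMatching  : IsCMatching H order
      edgesWithin  : EdgesWithin burnt order
      B⊆burnt      : B ⊆ burnt
      burnt⇒Burned : ∀ u → u ∈ burnt → Burned H B u
      ∣burnt∣≤     : ∣ burnt ∣ ≤ ∣ B ∣ + length order
  open BurningRun

  emptyRun : ∀ B → BurningRun B
  emptyRun B = record
    { burnt = B ; order = [] ; isCMatching = [] ; edgesWithin = []
    ; B⊆burnt = λ u∈B → u∈B ; burnt⇒Burned = λ _ → initial
    ; ∣burnt∣≤ = ≤-reflexive (sym (+-identityʳ ∣ B ∣)) }

  burnStep : ∀ {B v h} (r : BurningRun B) → Burnable (burnt r) v h → BurningRun B
  burnStep {B} {v} {h} r (v∉S , v∈h , h∖v⊆S) = record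
    { burnt        = ⁅ v ⁆ ∪ burnt r
    ; order        = order r ∷ʳ (v , h)
    ; isCMatching  = isCMatching-∷ʳ (isCMatching r) (edgesWithin r) v∉S v∈h
    ; edgesWithin  = ∷ʳ⁺ (All-map (λ e⊆S {u} u∈e → grow (e⊆S u∈e)) (edgesWithin r)) h⊆S′
    ; B⊆burnt      = λ u∈B → grow (B⊆burnt r u∈B)
    ; burnt⇒Burned = burned
    ; ∣burnt∣≤     = ∣S′∣≤
    }
    where
    grow : ∀ {u} → u ∈ burnt r → u ∈ ⁅ v ⁆ ∪ burnt r
    grow = x∈p∪q⁺ ∘ inj₂
    h⊆S′ : edge H h ⊆ ⁅ v ⁆ ∪ burnt r
    h⊆S′ {u} u∈h with u ≟ v
    ... | yes refl = x∈p∪q⁺ (inj₁ (x∈⁅x⁆ v))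
    ... | no u≢v   = grow (h∖v⊆S u u∈h u≢v)
    burned : ∀ u → u ∈ ⁅ v ⁆ ∪ burnt r → Burned H B u
    burned u u∈ with x∈⁅y⁆∪p⁻ v (burnt r) u∈
    ... | inj₁ refl = spread h v∈h λ w w∈h w≢v → burnt⇒Burned r w (h∖v⊆S w w∈h w≢v)
    ... | inj₂ u∈S  = burnt⇒Burned r u u∈S
    ∣S′∣≤ : ∣ ⁅ v ⁆ ∪ burnt r ∣ ≤ ∣ B ∣ + length (order r ∷ʳ (v , h))
    ∣S′∣≤ = begin
      ∣ ⁅ v ⁆ ∪ burnt r ∣                   ≡⟨ x∉p⇒∣⁅x⁆∪p∣≡1+∣p∣ v (burnt r) v∉S ⟩
      suc ∣ burnt r ∣                       ≤⟨ s≤s (∣burnt∣≤ r) ⟩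
      suc (∣ B ∣ + length (order r))        ≡⟨ +-suc ∣ B ∣ (length (order r)) ⟨
      ∣ B ∣ + suc (length (order r))        ≡⟨ cong (∣ B ∣ +_) (length-∷ʳ (order r)) ⟨
      ∣ B ∣ + length (order r ∷ʳ (v , h))   ∎
      where open ≤-Reasoning

  stuck⇒Burned⊆burnt : ∀ {B} (r : BurningRun B) → ¬ (∃[ v ] ∃[ h ] Burnable (burnt r) v h) →
    ∀ v → Burned H B v → v ∈ burnt r
  stuck⇒Burned⊆burnt r stuck v (initial v∈B) = B⊆burnt r v∈B
  stuck⇒Burned⊆burnt r stuck v (spread h v∈h rest) with v ∈? burnt r
  ... | yes v∈S = v∈S
  ... | no v∉S  = contradiction
    (v , h , v∉S , v∈h , λ u u∈h u≢v → stuck⇒Burned⊆burnt r stuck u (rest u u∈h u≢v)) stuck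

  CompleteRun : Subset (n H) → Set
  CompleteRun B = Σ (BurningRun B) λ r → ∀ v → Burned H B v → v ∈ burnt r

  -- Each step burns a new vertex, so at most n H steps are possible.
  completeRun : ∀ B → CompleteRun B
  completeRun B = run (n H) (emptyRun B) (m≤n+m (n H) ∣ B ∣)
    where
    run : ∀ k (r : BurningRun B) → n H ≤ ∣ burnt r ∣ + k → CompleteRun B
    run k r bound with burnable? (burnt r)
    ... | no stuck = r , stuck⇒Burned⊆burnt r stuck
    run zero    r bound | yes (v , _ , v∉S , _) =
      contradiction (subst (n H ≤_) (+-identityʳ _) bound) (<⇒≱ (x∉p⇒∣p∣<n v (burnt r) v∉S))
    run (suc k) r bound | yes (v , h , c@(v∉S , _)) = run k (burnStep r c) (begin
      n H                        ≤⟨ bound ⟩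
      ∣ burnt r ∣ + suc k        ≡⟨ +-suc ∣ burnt r ∣ k ⟩
      suc ∣ burnt r ∣ + k        ≡⟨ cong (_+ k) (x∉p⇒∣⁅x⁆∪p∣≡1+∣p∣ v (burnt r) v∉S) ⟨
      ∣ ⁅ v ⁆ ∪ burnt r ∣ + k    ∎)
      where open ≤-Reasoning

  isLazyBurningSet? : Decidable (IsLazyBurningSet H)
  isLazyBurningSet? B with completeRun B
  ... | r , complete with all? (_∈? burnt r)
  ...   | yes all∈ = yes λ v → burnt⇒Burned r v (all∈ v)
  ...   | no ¬all∈ = no λ burnsAll → ¬all∈ λ v → complete v (burnsAll v)

  lazyBurningSet⇒long-cMatching : ∀ {B} → IsLazyBurningSet H B →
    ∃[ M ] (IsCMatching H M × n H ∸ ∣ B ∣ ≤ length M)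
  lazyBurningSet⇒long-cMatching {B} burnsAll with completeRun B
  ... | r , complete =
    order r , isCMatching r , m≤n+o⇒m∸n≤o (n H) ∣ B ∣ (≤-trans n≤∣burnt∣ (∣burnt∣≤ r))
    where
    n≤∣burnt∣ : n H ≤ ∣ burnt r ∣
    n≤∣burnt∣ = subst (_≤ ∣ burnt r ∣) (∣⊤∣≡n (n H))
      (p⊆q⇒∣p∣≤∣q∣ {p = ⊤} λ {v} _ → complete v (burnsAll v))

  lazyBurningNumber : ∃[ b ] IsLazyBurningNumber H b
  lazyBurningNumber with minimumCardinality isLazyBurningSet? {⊤} (λ v → initial ∈⊤)
  ... | B , burnsAll , minimal = ∣ B ∣ , (B , burnsAll , refl) , minimal

corollary2p3 : (H : Hypergraph) →
    ((M : List (Fin (n H) × Edge H)) → IsCMatching H M →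
      IsLazyBurningSet H (∁ (matchedVertices H M)))
    × (∃[ b ] (IsLazyBurningNumber H b × IsMaxCMatchingSize H (n H ∸ b)))
corollary2p3 H with lazyBurningNumber H
... | b , isB@((_ , burnsAll , refl) , minimal)
    with lazyBurningSet⇒long-cMatching H burnsAll
... | M , cm , lower =
  ∁matchedVertices-isLazyBurningSet H ,
  (b , isB , (M , cm , ≤-antisym (upper M cm) lower) , upper)
  where
  upper : ∀ M → IsCMatching H M → length M ≤ n H ∸ b
  upper = cMatching-length≤n∸b H minimal
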